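{- Let $n\ge1$, $\sigma\in\mathfrak{D}_{n+1}$, $i\in[2n-1]$, $\sigma'=\sigma\circ(e_i,e_{i+1})$, and suppose $\varphi(\sigma)$ is switchable at $i$ (in which case $\sigma'\in\mathfrak{D}_{n+1}$). Then the following are equivalent: (1) $\varphi(\sigma')\neq\varphi(\sigma)$; (2) the dots $e_i$ and $e_{i+1}$ are not in the same column of $\varphi(\sigma)$; (3) $\mathrm{inv}(\varphi(\sigma'))-\mathrm{inv}(\varphi(\sigma))=\pm1$; (4) $\phi(\varphi(\sigma))\circ(e_i,e_{i+1})\in\mathfrak{D}_{n+1}'$; (5) $\phi(\varphi(\sigma'))=\phi(\varphi(\sigma))\circ(e_i,e_{i+1})$.
   Context: A Dumont permutation of order $2m$ is $\sigma\in\mathfrak{S}_{2m}$ with $\sigma(2i)<2i$, $\sigma(2i-1)>2i-1$ for all $i\in[m]$ (set $\mathfrak{D}_m$); it is normalized if for every $j\in[m-1]$, $\sigma^{ -1}(2j)$ and $\sigma^{ -1}(2j+1)$ have the same parity iff $\sigma^{ -1}(2j)>\sigma^{ -1}(2j+1)$ (set $\mathfrak{D}_m'$). $(e_i,e_{i+1})$ denotes the transposition of $[2n+2]$ exchanging $e_i$ and $e_{i+1}$. Grids and labels: grids have $n$ columns (indexed $1..n$ left to right) and $2n$ rows (indexed $1..2n$ bottom to top); row $i\le n$ carries label $e_i=2i+2$, row $n+i$ ($i\in[n]$) carries label $e_{n+i}=2i-1$; dots are identified with the labels of their rows. A Dellac configuration of size $n$ is such a grid with $2n$ dots, one per row and two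 per column, each dot in column $j$, row $i$ with $j\le i\le j+n$; $DC(n)$ is their set. An inversion is a pair of dots with (column,row) coordinates $(j_1,i_1),(j_2,i_2)$, $j_1<j_2$, $i_1>i_2$; $\mathrm{inv}$ counts them. For $\sigma\in\mathfrak{D}_{n+1}$, $\varphi(\sigma)\in DC(n)$ is the configuration whose $j$-th column contains the dots labelled $\sigma^{ -1}(2j)$ and $\sigma^{ -1}(2j+1)$. For $C\in DC(n)$ with $i_1(j)<i_2(j)$ the rows of the dots in column $j$, $\phi(C)\in\mathfrak{S}_{2n+2}$ is defined by $\phi(C)^{ -1}(1)=2$, $\phi(C)^{ -1}(2j)=e_{i_2(j)}$, $\phi(C)^{ -1}(2j+1)=e_{i_1(j)}$ ($j\in[n]$), $\phi(C)^{ -1}(2n+2)=2n+1$. For $C\in DC(n)$ and $i\in[2n-1]$, $Sw^i(C)$ is obtained by exchanging the columns of the dots $e_i$ and $e_{i+1}$, and $C$ is switchable at $i$ if $Sw^i(C)\in DC(n)$. -}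

module Defs where

open import Data.Nat using (ℕ; zero; suc; _+_; _*_; _∸_; _≤_; _<_; _≟_; _≤?_; _<?_)
open import Data.Nat.DivMod using (_/_; _%_)
open import Data.Bool using (Bool; if_then_else_)
open import Data.List using (List; map; filter; length; upTo; head; last)
open import Data.Nat.ListAction using (sum)
open import Data.Maybe using (Maybe; just; nothing)
open import Data.Product using (_×_; _,_)
open import Relation.Nullary using (¬_)
open import Relation.Nullary.Decidable using (⌊_⌋; _×-dec_)
open import Relation.Binary.PropositionalEquality using (_≡_)

-- Conventions: everything is 1-based and lives in ℕ.
-- A permutation of [N] = {1,…,N} is a function ℕ → ℕ that maps [N]
-- injectively into [N] (values outside [N] are irrelevant).

interval : ℕ → List ℕ
interval N = map suc (upTo N)

InRange : ℕ → ℕ → Set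
InRange N x = 1 ≤ x × x ≤ N

IsPerm : ℕ → (ℕ → ℕ) → Set
IsPerm N σ =
  (∀ x → InRange N x → InRange N (σ x)) ×
  (∀ x y → InRange N x → InRange N y → σ x ≡ σ y → x ≡ y)

PermEq : ℕ → (ℕ → ℕ) → (ℕ → ℕ) → Set
PermEq N σ τ = ∀ x → InRange N x → σ x ≡ τ x

swap : ℕ → ℕ → ℕ → ℕ
swap a b x = if ⌊ x ≟ a ⌋ then b else (if ⌊ x ≟ b ⌋ then a else x)

_∘'_ : (ℕ → ℕ) → (ℕ → ℕ) → (ℕ → ℕ)
(σ ∘' τ) x = σ (τ x)

IsDumont : ℕ → (ℕ → ℕ) → Set
IsDumont m σ =
  IsPerm (2 * m) σ ×
  (∀ i → 1 ≤ i → i ≤ m →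
     (σ (2 * i) < 2 * i) × (2 * i ∸ 1 < σ (2 * i ∸ 1)))

IsNormalizedDumont : ℕ → (ℕ → ℕ) → Set
IsNormalizedDumont m σ =
  IsDumont m σ ×
  (∀ j → 1 ≤ j → j ≤ m ∸ 1 →
     ∀ a b → InRange (2 * m) a → InRange (2 * m) b →
       σ a ≡ 2 * j → σ b ≡ 2 * j + 1 →
       ((a % 2 ≡ b % 2 → b < a) × (b < a → a % 2 ≡ b % 2)))

lab : ℕ → ℕ → ℕ
lab n r = if ⌊ r ≤? n ⌋ then 2 * r + 2 else 2 * (r ∸ n) ∸ 1

-- A grid configuration of size n with exactly one dot per row is
-- given by the column C r ∈ [n] of the dot in row r ∈ [2n].
Config : Set
Config = ℕ → ℕ

ConfEq : ℕ → Config → Config → Set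
ConfEq n C D = ∀ r → InRange (2 * n) r → C r ≡ D r

colRows : ℕ → Config → ℕ → List ℕ
colRows n C j = filter (λ r → C r ≟ j) (interval (2 * n))

IsDC : ℕ → Config → Set
IsDC n C =
  (∀ r → InRange (2 * n) r → InRange n (C r) × C r ≤ r × r ≤ C r + n) ×
  (∀ j → InRange n j → length (colRows n C j) ≡ 2)

inv : ℕ → Config → ℕ
inv n C = sum (map (λ a → length (filter (λ b → (C a <? C b) ×-dec (b <? a))
                                         (interval (2 * n))))
                   (interval (2 * n)))

-- φ(σ) for σ ∈ 𝔇_{n+1}: column j contains the dots labelled σ⁻¹(2j)
-- and σ⁻¹(2j+1), i.e. the dot of row r lies in column ⌊σ(e_r)/2⌋.
varphi : ℕ → (ℕ → ℕ) → Config
varphi n σ r = σ (lab n r) / 2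

-- Sw^i(C): exchange the columns of the dots e_i and e_{i+1}
-- (the dot e_r is the dot of row r)
Sw : ℕ → Config → Config
Sw i C r = C (swap i (suc i) r)

Switchable : ℕ → Config → ℕ → Set
Switchable n C i = IsDC n (Sw i C)

head0 : List ℕ → ℕ
head0 xs with head xs
... | just x = x
... | nothing = 0

last0 : List ℕ → ℕ
last0 xs with last xs
... | just x = x
... | nothing = 0

i₁ i₂ : ℕ → Config → ℕ → ℕ
i₁ n C j = head0 (colRows n C j)
i₂ n C j = last0 (colRows n C j)

-- φ(C)⁻¹ as in the paper:
-- 1 ↦ 2, 2j ↦ e_{i₂(j)}, 2j+1 ↦ e_{i₁(j)} (j ∈ [n]), 2n+2 ↦ 2n+1
phiInv : ℕ → Config → ℕ → ℕ
phiInv n C x =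
  if ⌊ x ≟ 1 ⌋ then 2
  else if ⌊ x ≟ 2 * n + 2 ⌋ then 2 * n + 1
  else if ⌊ x % 2 ≟ 0 ⌋ then lab n (i₂ n C (x / 2))
  else lab n (i₁ n C (x / 2))

invOn : ℕ → (ℕ → ℕ) → ℕ → ℕ
invOn N f y = head0 (filter (λ x → f x ≟ y) (interval N))

phi : ℕ → Config → (ℕ → ℕ)
phi n C = invOn (2 * n + 2) (phiInv n C)

module Submission where

-- Write s = (i,i+1) for the transposition of rows and τ = (e_i,e_{i+1}) for
-- the transposition of labels.  Since τ(e_r) = e_{s(r)}, the configuration
-- φ(σ∘τ) is Sw^i C, and everything splits on whether the dots e_i, e_{i+1}
-- share a column of C.
--  * Same column j: Sw^i C = C, so (1), (3) and (5) fail; and (4) fails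
--    because φ(C)∘τ sends e_i, e_{i+1} to 2j, 2j+1 while two consecutive
--    labels e_i, e_{i+1} always violate the normalisation condition.
--  * Different columns: (1) holds; exchanging two adjacent rows changes the
--    inversion count by exactly one (inversion-swap), giving (3); the columns
--    of Sw^i C are the s-images of those of C in the same order, whence
--    φ(Sw^i C) = φ(C)∘τ, giving (5); and φ of every Dellac configuration is
--    a normalised Dumont permutation (phi-normalized), giving (4).

open import Defs
open import Data.Nat using (ℕ; zero; suc; _+_; _*_; _∸_; _≤_; _<_; _≟_; _≤?_; _<?_; z≤n; s≤s)
open import Data.Nat.Properties
open import Data.Nat.DivMod using (_/_; _%_; m*n%n≡0; [m+kn]%n≡m%n; m*n/n≡m; +-distrib-/)
open import Data.Nat.ListAction using (sum)
open import Data.Nat.Solver using (module +-*-Solver)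
open import Data.Integer using (+_; -_; _-_; _⊖_)
open import Data.Integer.Properties using ([+m]-[+n]≡m⊖n; ⊖-≥; ⊖-<; i≡j⇒i-j≡0)
open import Data.List using (List; []; _∷_; map; filter; length)
open import Data.List.Membership.Propositional using (_∈_)
open import Data.List.Membership.Propositional.Properties using (∈-map⁺; ∈-map⁻; ∈-upTo⁺; ∈-upTo⁻; ∈-filter⁺; ∈-filter⁻)
open import Data.List.Relation.Unary.Any using (here; there)
open import Data.List.Relation.Unary.All using (All; []; _∷_)
open import Data.List.Relation.Unary.AllPairs using (AllPairs; []; _∷_)
import Data.List.Relation.Unary.AllPairs as AllPairs
import Data.List.Relation.Unary.AllPairs.Properties as AllPairsₚ
open import Data.Product using (_×_; _,_; proj₁; proj₂; Σ)
open import Data.Sum using (_⊎_; inj₁; inj₂; [_,_])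
open import Data.Empty using (⊥; ⊥-elim)
open import Function using (id; _∘_)
open import Function.Bundles using (_⇔_; mk⇔)
open import Level using (0ℓ)
open import Relation.Nullary using (¬_; Dec; yes; no)
open import Relation.Nullary.Decidable using (_×-dec_)
open import Relation.Unary using (Pred; Decidable)
open import Relation.Binary.PropositionalEquality using (_≡_; _≢_; refl; sym; trans; cong; cong₂; subst; subst₂; module ≡-Reasoning)
open +-*-Solver using (solve; _:+_; _:*_; _:=_; con)

swap-left : ∀ a b → swap a b a ≡ b
swap-left a b with a ≟ a
... | yes _ = refl
... | no a≢a = ⊥-elim (a≢a refl)

swap-right : ∀ a b → a ≢ b → swap a b b ≡ a
swap-right a b a≢b with b ≟ a
... | yes b≡a = ⊥-elim (a≢b (sym b≡a))
... | no _ with b ≟ b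
... | yes _ = refl
... | no b≢b = ⊥-elim (b≢b refl)

swap-other : ∀ a b x → x ≢ a → x ≢ b → swap a b x ≡ x
swap-other a b x x≢a x≢b with x ≟ a
... | yes x≡a = ⊥-elim (x≢a x≡a)
... | no _ with x ≟ b
... | yes x≡b = ⊥-elim (x≢b x≡b)
... | no _ = refl

data SwapView (a b x : ℕ) : Set where
  at-a : x ≡ a → SwapView a b x
  at-b : x ≡ b → SwapView a b x
  elsewhere : x ≢ a → x ≢ b → SwapView a b x

swapView : ∀ a b x → SwapView a b x
swapView a b x with x ≟ a
... | yes x≡a = at-a x≡a
... | no x≢a with x ≟ b
... | yes x≡b = at-b x≡b
... | no x≢b = elsewhere x≢a x≢b

swap-involutive : ∀ a b x → a ≢ b → swap a b (swap a b x) ≡ x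
swap-involutive a b x a≢b with swapView a b x
... | at-a refl = trans (cong (swap x b) (swap-left x b)) (swap-right x b a≢b)
... | at-b refl = trans (cong (swap a x) (swap-right a x a≢b)) (swap-left a x)
... | elsewhere x≢a x≢b = trans (cong (swap a b) (swap-other a b x x≢a x≢b)) (swap-other a b x x≢a x≢b)

-- The adjacent transposition s = (i, i+1) preserves the order of every pair
-- except (i, i+1) itself; this is why exchanging two adjacent rows changes
-- only the inversions between those two rows.
module AdjacentSwap (i : ℕ) where
  s : ℕ → ℕ
  s = swap i (suc i)

  i≢1+i : i ≢ suc i
  i≢1+i = <⇒≢ (n<1+n i)

  s-i : s i ≡ suc i
  s-i = swap-left i (suc i)

  s-1+i : s (suc i) ≡ i
  s-1+i = swap-right i (suc i) i≢1+i

  s-involutive : ∀ x → s (s x) ≡ x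
  s-involutive x = swap-involutive i (suc i) x i≢1+i

  swap-preserves-< : ∀ x y → x < y → ¬ (x ≡ i × y ≡ suc i) → s x < s y
  swap-preserves-< x y x<y not-ii' with swapView i (suc i) x | swapView i (suc i) y
  ... | at-a refl | at-a refl = ⊥-elim (<-irrefl refl x<y)
  ... | at-a refl | at-b refl = ⊥-elim (not-ii' (refl , refl))
  ... | at-a refl | elsewhere y≢i y≢1+i rewrite swap-left x (suc x) | swap-other x (suc x) y y≢i y≢1+i =
        ≤∧≢⇒< x<y (λ e → y≢1+i (sym e))
  ... | at-b refl | at-a refl = ⊥-elim (<-asym x<y (n<1+n y))
  ... | at-b refl | at-b refl = ⊥-elim (<-irrefl refl x<y)
  ... | at-b refl | elsewhere y≢i y≢1+i rewrite s-1+i | swap-other i (suc i) y y≢i y≢1+i = <-trans (n<1+n i) x<y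
  ... | elsewhere x≢i x≢1+i | at-a refl rewrite swap-left y (suc y) | swap-other y (suc y) x x≢i x≢1+i =
        <-trans x<y (n<1+n y)
  ... | elsewhere x≢i x≢1+i | at-b refl rewrite s-1+i | swap-other i (suc i) x x≢i x≢1+i = ≤∧≢⇒< (≤-pred x<y) x≢i
  ... | elsewhere x≢i x≢1+i | elsewhere y≢i y≢1+i
      rewrite swap-other i (suc i) x x≢i x≢1+i | swap-other i (suc i) y y≢i y≢1+i = x<y

  swap-order-off : ∀ a b → a ≢ i → a ≢ suc i → (b < a → s b < s a) × (s b < s a → b < a)
  swap-order-off a b a≢i a≢1+i =
    (λ b<a → swap-preserves-< b a b<a (λ { (_ , a≡1+i) → a≢1+i a≡1+i })) ,
    (λ lt → subst₂ _<_ (s-involutive b) (s-involutive a)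
               (swap-preserves-< (s b) (s a) lt (λ { (_ , e) → a≢1+i (trans (sym sa≡a) e) })))
    where
    sa≡a : s a ≡ a
    sa≡a = swap-other i (suc i) a a≢i a≢1+i

interval-sorted : ∀ N → AllPairs _<_ (interval N)
interval-sorted N = AllPairsₚ.map⁺ (AllPairsₚ.applyUpTo⁺₁ id N (λ i<j _ → s≤s i<j))

interval-unique : ∀ N → AllPairs _≢_ (interval N)
interval-unique N = AllPairs.map <⇒≢ (interval-sorted N)

∈-interval⁺ : ∀ {N x} → InRange N x → x ∈ interval N
∈-interval⁺ {N} {suc y} (_ , y<N) = ∈-map⁺ suc (∈-upTo⁺ y<N)

∈-interval⁻ : ∀ {N x} → x ∈ interval N → InRange N x
∈-interval⁻ p with ∈-map⁻ suc p
... | y , y∈ , refl = s≤s z≤n , ∈-upTo⁻ y∈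

head-∉ : ∀ {x : ℕ} {xs} → All (x ≢_) xs → x ∈ xs → ⊥
head-∉ (x≢x ∷ _) (here refl) = x≢x refl
head-∉ (_ ∷ x∉) (there x∈) = head-∉ x∉ x∈

sum-cong : ∀ (h h' : ℕ → ℕ) xs → (∀ y → y ∈ xs → h y ≡ h' y) →
  sum (map h xs) ≡ sum (map h' xs)
sum-cong h h' [] _ = refl
sum-cong h h' (x ∷ xs) agree =
  cong₂ _+_ (agree x (here refl)) (sum-cong h h' xs (λ y y∈ → agree y (there y∈)))

sum-update : ∀ (h h' : ℕ → ℕ) {xs x} → AllPairs _≢_ xs → x ∈ xs →
  (∀ y → y ∈ xs → y ≢ x → h y ≡ h' y) →
  sum (map h xs) + h' x ≡ sum (map h' xs) + h x
sum-update h h' {y ∷ ys} (y∉ys ∷ _) (here refl) agree =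
  begin
    h y + sum (map h ys) + h' y
      ≡⟨ cong (λ t → h y + t + h' y) (sum-cong h h' ys (λ z z∈ → agree z (there z∈) (λ { refl → head-∉ y∉ys z∈ }))) ⟩
    h y + sum (map h' ys) + h' y
      ≡⟨ solve 3 (λ a t b → a :+ t :+ b := b :+ t :+ a) refl (h y) (sum (map h' ys)) (h' y) ⟩
    h' y + sum (map h' ys) + h y ∎
  where open ≡-Reasoning
sum-update h h' {y ∷ ys} {x} (y∉ys ∷ u) (there x∈) agree =
  begin
    h y + sum (map h ys) + h' x   ≡⟨ +-assoc (h y) _ _ ⟩
    h y + (sum (map h ys) + h' x) ≡⟨ cong₂ _+_ (agree y (here refl) y≢x) (sum-update h h' u x∈ (λ z z∈ → agree z (there z∈))) ⟩
    h' y + (sum (map h' ys) + h x) ≡⟨ sym (+-assoc (h' y) _ _) ⟩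
    h' y + sum (map h' ys) + h x  ∎
  where
  open ≡-Reasoning
  y≢x : y ≢ x
  y≢x refl = head-∉ y∉ys x∈

sum-update₂ : ∀ (h h' : ℕ → ℕ) {xs x z} → AllPairs _≢_ xs → x ∈ xs → z ∈ xs → x ≢ z →
  (∀ y → y ∈ xs → y ≢ x → y ≢ z → h y ≡ h' y) →
  sum (map h xs) + h' x + h' z ≡ sum (map h' xs) + h x + h z
sum-update₂ h h' {xs} {x} {z} u x∈ z∈ x≢z agree =
  begin
    sum (map h xs) + h' x + h' z  ≡⟨ cong (λ t → sum (map h xs) + t + h' z) (sym k-x) ⟩
    sum (map h xs) + k x + h' z   ≡⟨ cong (_+ h' z) (sum-update h k u x∈ (λ y _ y≢x → sym (k-off y y≢x))) ⟩
    sum (map k xs) + h x + h' z   ≡⟨ exchange (sum (map k xs)) (h x) (h' z) ⟩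
    sum (map k xs) + h' z + h x   ≡⟨ cong (_+ h x) (sum-update k h' u z∈ k-agree) ⟩
    sum (map h' xs) + k z + h x   ≡⟨ cong (λ t → sum (map h' xs) + t + h x) k-z ⟩
    sum (map h' xs) + h z + h x   ≡⟨ exchange (sum (map h' xs)) (h z) (h x) ⟩
    sum (map h' xs) + h x + h z   ∎
  where
  open ≡-Reasoning
  exchange : ∀ a b c → a + b + c ≡ a + c + b
  exchange = solve 3 (λ a b c → a :+ b :+ c := a :+ c :+ b) refl
  k : ℕ → ℕ
  k y with y ≟ x
  ... | yes _ = h' y
  ... | no _ = h y
  k-x : k x ≡ h' x
  k-x with x ≟ x
  ... | yes _ = refl
  ... | no x≢x = ⊥-elim (x≢x refl)
  k-off : ∀ y → y ≢ x → k y ≡ h y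
  k-off y y≢x with y ≟ x
  ... | yes y≡x = ⊥-elim (y≢x y≡x)
  ... | no _ = refl
  k-z : k z ≡ h z
  k-z = k-off z (λ z≡x → x≢z (sym z≡x))
  k-agree : ∀ y → y ∈ xs → y ≢ z → k y ≡ h' y
  k-agree y y∈ y≢z with y ≟ x
  ... | yes _ = refl
  ... | no y≢x = agree y y∈ y≢x y≢z

sum-swap : ∀ (h : ℕ → ℕ) {xs a b} → AllPairs _≢_ xs → a ∈ xs → b ∈ xs → a ≢ b →
  sum (map (h ∘ swap a b) xs) ≡ sum (map h xs)
sum-swap h {xs} {a} {b} u a∈ b∈ a≢b = +-cancelʳ-≡ (h a + h b) _ _
  (begin
    sum (map (h ∘ swap a b) xs) + (h a + h b) ≡⟨ sym (+-assoc _ (h a) (h b)) ⟩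
    sum (map (h ∘ swap a b) xs) + h a + h b
      ≡⟨ sum-update₂ (h ∘ swap a b) h u a∈ b∈ a≢b (λ y _ y≢a y≢b → cong h (swap-other a b y y≢a y≢b)) ⟩
    sum (map h xs) + h (swap a b a) + h (swap a b b)
      ≡⟨ cong₂ (λ p q → sum (map h xs) + h p + h q) (swap-left a b) (swap-right a b a≢b) ⟩
    sum (map h xs) + h b + h a
      ≡⟨ solve 3 (λ t p q → t :+ q :+ p := t :+ (p :+ q)) refl (sum (map h xs)) (h a) (h b) ⟩
    sum (map h xs) + (h a + h b) ∎)
  where open ≡-Reasoning

-- Inversion counts as double sums of indicators.

indicator : ∀ {P : Set} → Dec P → ℕ
indicator (yes _) = 1
indicator (no _) = 0

length-filter≡sum : ∀ {P : Pred ℕ 0ℓ} (P? : Decidable P) xs →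
  length (filter P? xs) ≡ sum (map (λ b → indicator (P? b)) xs)
length-filter≡sum P? [] = refl
length-filter≡sum P? (x ∷ xs) with P? x
... | yes _ = cong suc (length-filter≡sum P? xs)
... | no _ = length-filter≡sum P? xs

-- [p < q ∧ r < t]: for dots in rows t, r and columns p, q it detects an inversion
inversionInd : ℕ → ℕ → ℕ → ℕ → ℕ
inversionInd p q r t = indicator ((p <? q) ×-dec (r <? t))

inversionInd-cong : ∀ p q r t r' t' → (r < t → r' < t') → (r' < t' → r < t) →
  inversionInd p q r t ≡ inversionInd p q r' t'
inversionInd-cong p q r t r' t' to from with p <? q | r <? t | r' <? t'
... | yes _ | yes r<t | no r'≮t' = ⊥-elim (r'≮t' (to r<t))
... | yes _ | no r≮t | yes r'<t' = ⊥-elim (r≮t (from r'<t'))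
... | yes _ | yes _ | yes _ = refl
... | yes _ | no _ | no _ = refl
... | no _ | _ | _ = refl

inversionInd-≮ : ∀ p q r t → ¬ r < t → inversionInd p q r t ≡ 0
inversionInd-≮ p q r t r≮t with p <? q | r <? t
... | yes _ | yes r<t = ⊥-elim (r≮t r<t)
... | yes _ | no _ = refl
... | no _ | _ = refl

inversionInd-< : ∀ p q r t → r < t → inversionInd p q r t ≡ indicator (p <? q)
inversionInd-< p q r t r<t with p <? q | r <? t
... | yes _ | yes _ = refl
... | yes _ | no r≮t = ⊥-elim (r≮t r<t)
... | no _ | _ = refl

invSum : ℕ → Config → ℕ
invSum N C = sum (map (λ a → sum (map (λ b → inversionInd (C a) (C b) b a) (interval N))) (interval N))

inv≡invSum : ∀ n C → inv n C ≡ invSum (2 * n) C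
inv≡invSum n C = sum-cong _ _ (interval (2 * n))
  (λ a _ → length-filter≡sum (λ b → (C a <? C b) ×-dec (b <? a)) (interval (2 * n)))

invSum-cong : ∀ N C C' → (∀ r → C r ≡ C' r) → invSum N C ≡ invSum N C'
invSum-cong N C C' C≡C' = sum-cong _ _ (interval N) (λ a _ → sum-cong _ _ (interval N)
  (λ b _ → cong₂ (λ p q → inversionInd p q b a) (C≡C' a) (C≡C' b)))

-- Exchanging the columns of rows i and i+1 only changes whether this pair is
-- an inversion: the count row a contributes is unchanged for a ∉ {i, i+1}
-- (swap-order-off), and rows i, i+1 each lose or gain only their mutual term.
module InversionSwap (N i : ℕ) (1≤i : 1 ≤ i) (1+i≤N : suc i ≤ N) (D : Config) where
  open AdjacentSwap i

  private
    L : List ℕ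
    L = interval N

    i∈L : i ∈ L
    i∈L = ∈-interval⁺ (1≤i , ≤-trans (n≤1+n i) 1+i≤N)

    1+i∈L : suc i ∈ L
    1+i∈L = ∈-interval⁺ (s≤s z≤n , 1+i≤N)

    row rowSwapped : ℕ → ℕ
    row a = sum (map (λ b → inversionInd (D a) (D b) b a) L)
    rowSwapped a = sum (map (λ b → inversionInd (D a) (D b) (s b) (s a)) L)

    invSum-swapped : invSum N (D ∘ s) ≡ sum (map rowSwapped L)
    invSum-swapped = begin
      invSum N (D ∘ s)
        ≡⟨ sum-cong _ _ L (λ a _ → sum-cong _ _ L (λ b _ →
             cong₂ (inversionInd (D (s a)) (D (s b))) (sym (s-involutive b)) (sym (s-involutive a)))) ⟩
      sum (map (λ a → sum (map (λ b → inversionInd (D (s a)) (D (s b)) (s (s b)) (s (s a))) L)) L)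
        ≡⟨ sum-cong _ _ L (λ a _ →
             sum-swap (λ b → inversionInd (D (s a)) (D b) (s b) (s (s a))) (interval-unique N) i∈L 1+i∈L i≢1+i) ⟩
      sum (map (rowSwapped ∘ s) L)
        ≡⟨ sum-swap rowSwapped (interval-unique N) i∈L 1+i∈L i≢1+i ⟩
      sum (map rowSwapped L) ∎
      where open ≡-Reasoning

    row-off : ∀ a → a ∈ L → a ≢ i → a ≢ suc i → row a ≡ rowSwapped a
    row-off a _ a≢i a≢1+i = sum-cong _ _ L (λ b _ →
      inversionInd-cong _ _ _ _ _ _ (proj₁ (swap-order-off a b a≢i a≢1+i)) (proj₂ (swap-order-off a b a≢i a≢1+i)))

    row-i : row i + indicator (D i <? D (suc i)) ≡ rowSwapped i
    row-i = begin
      row i + indicator (D i <? D (suc i))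
        ≡⟨ cong (λ t → row i + t) (sym (trans (cong₂ (inversionInd (D i) (D (suc i))) s-1+i s-i)
                                         (inversionInd-< _ _ _ _ (n<1+n i)))) ⟩
      row i + inversionInd (D i) (D (suc i)) (s (suc i)) (s i)
        ≡⟨ sum-update (λ b → inversionInd (D i) (D b) b i) (λ b → inversionInd (D i) (D b) (s b) (s i))
             (interval-unique N) 1+i∈L agree ⟩
      rowSwapped i + inversionInd (D i) (D (suc i)) (suc i) i
        ≡⟨ cong (λ t → rowSwapped i + t) (inversionInd-≮ _ _ _ _ (λ lt → <-asym lt (n<1+n i))) ⟩
      rowSwapped i + 0
        ≡⟨ +-identityʳ (rowSwapped i) ⟩
      rowSwapped i ∎
      where
      open ≡-Reasoning
      agree : ∀ b → b ∈ L → b ≢ suc i → inversionInd (D i) (D b) b i ≡ inversionInd (D i) (D b) (s b) (s i)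
      agree b _ b≢1+i rewrite s-i with swapView i (suc i) b
      ... | at-a refl rewrite s-i =
            trans (inversionInd-≮ _ _ _ _ (<-irrefl refl)) (sym (inversionInd-≮ _ _ _ _ (<-irrefl refl)))
      ... | at-b b≡1+i = ⊥-elim (b≢1+i b≡1+i)
      ... | elsewhere b≢i _ rewrite swap-other i (suc i) b b≢i b≢1+i =
            inversionInd-cong _ _ _ _ _ _ (λ lt → <-trans lt (n<1+n i)) (λ lt → ≤∧≢⇒< (≤-pred lt) b≢i)

    row-1+i : row (suc i) ≡ rowSwapped (suc i) + indicator (D (suc i) <? D i)
    row-1+i = begin
      row (suc i)
        ≡⟨ sym (+-identityʳ _) ⟩
      row (suc i) + 0
        ≡⟨ cong (λ t → row (suc i) + t) (sym (trans (cong₂ (inversionInd (D (suc i)) (D i)) s-i s-1+i)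
                                               (inversionInd-≮ _ _ _ _ (λ lt → <-asym lt (n<1+n i))))) ⟩
      row (suc i) + inversionInd (D (suc i)) (D i) (s i) (s (suc i))
        ≡⟨ sum-update (λ b → inversionInd (D (suc i)) (D b) b (suc i)) (λ b → inversionInd (D (suc i)) (D b) (s b) (s (suc i)))
             (interval-unique N) i∈L agree ⟩
      rowSwapped (suc i) + inversionInd (D (suc i)) (D i) i (suc i)
        ≡⟨ cong (λ t → rowSwapped (suc i) + t) (inversionInd-< _ _ _ _ (n<1+n i)) ⟩
      rowSwapped (suc i) + indicator (D (suc i) <? D i) ∎
      where
      open ≡-Reasoning
      agree : ∀ b → b ∈ L → b ≢ i →
        inversionInd (D (suc i)) (D b) b (suc i) ≡ inversionInd (D (suc i)) (D b) (s b) (s (suc i))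
      agree b _ b≢i rewrite s-1+i with swapView i (suc i) b
      ... | at-a b≡i = ⊥-elim (b≢i b≡i)
      ... | at-b refl rewrite s-1+i =
            trans (inversionInd-≮ _ _ _ _ (<-irrefl refl)) (sym (inversionInd-≮ _ _ _ _ (<-irrefl refl)))
      ... | elsewhere _ b≢1+i rewrite swap-other i (suc i) b b≢i b≢1+i =
            inversionInd-cong _ _ _ _ _ _ (λ lt → ≤∧≢⇒< (≤-pred lt) b≢i) (λ lt → <-trans lt (n<1+n i))

  inversion-swap : invSum N D + indicator (D i <? D (suc i)) ≡ invSum N (D ∘ s) + indicator (D (suc i) <? D i)
  inversion-swap = trans (+-cancelʳ-≡ (row i + rowSwapped (suc i)) _ _ balance) (cong (_+ d₂) (sym invSum-swapped))
    where
    open ≡-Reasoning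
    X Y d₁ d₂ : ℕ
    X = sum (map row L)
    Y = sum (map rowSwapped L)
    d₁ = indicator (D i <? D (suc i))
    d₂ = indicator (D (suc i) <? D i)
    balance : X + d₁ + (row i + rowSwapped (suc i)) ≡ Y + d₂ + (row i + rowSwapped (suc i))
    balance = begin
      X + d₁ + (row i + rowSwapped (suc i))
        ≡⟨ solve 5 (λ x d u v w → x :+ d :+ (u :+ w) := x :+ (u :+ d) :+ w) refl X d₁ (row i) (rowSwapped i) (rowSwapped (suc i)) ⟩
      X + (row i + d₁) + rowSwapped (suc i)
        ≡⟨ cong (λ t → X + t + rowSwapped (suc i)) row-i ⟩
      X + rowSwapped i + rowSwapped (suc i)
        ≡⟨ sum-update₂ row rowSwapped (interval-unique N) i∈L 1+i∈L i≢1+i (λ a a∈ → row-off a a∈) ⟩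
      Y + row i + row (suc i)
        ≡⟨ cong (λ t → Y + row i + t) row-1+i ⟩
      Y + row i + (rowSwapped (suc i) + d₂)
        ≡⟨ solve 4 (λ y u w d → y :+ u :+ (w :+ d) := y :+ d :+ (u :+ w)) refl Y (row i) (rowSwapped (suc i)) d₂ ⟩
      Y + d₂ + (row i + rowSwapped (suc i)) ∎

differ-by-one : ∀ X Y p q → p ≢ q → X + indicator (p <? q) ≡ Y + indicator (q <? p) →
  (+ X - + Y ≡ + 1) ⊎ (+ X - + Y ≡ - + 1)
differ-by-one X Y p q p≢q e with p <? q | q <? p
... | yes p<q | yes q<p = ⊥-elim (<-asym p<q q<p)
... | yes _ | no _ = inj₂ (begin
      + X - + Y         ≡⟨ cong (λ y → + X - + y) (sym (trans e (+-identityʳ Y))) ⟩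
      + X - + (X + 1)   ≡⟨ [+m]-[+n]≡m⊖n X (X + 1) ⟩
      X ⊖ (X + 1)       ≡⟨ ⊖-< (subst (X <_) (+-comm 1 X) ≤-refl) ⟩
      - + (X + 1 ∸ X)   ≡⟨ cong (λ d → - + d) (m+n∸m≡n X 1) ⟩
      - + 1 ∎)
  where open ≡-Reasoning
... | no _ | yes _ = inj₁ (begin
      + X - + Y         ≡⟨ cong (λ x → + x - + Y) (trans (sym (+-identityʳ X)) e) ⟩
      + (Y + 1) - + Y   ≡⟨ [+m]-[+n]≡m⊖n (Y + 1) Y ⟩
      (Y + 1) ⊖ Y       ≡⟨ ⊖-≥ (m≤m+n Y 1) ⟩
      + (Y + 1 ∸ Y)     ≡⟨ cong +_ (m+n∸m≡n Y 1) ⟩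
      + 1 ∎)
  where open ≡-Reasoning
... | no p≮q | no q≮p = ⊥-elim (p≢q (≤-antisym (≮⇒≥ q≮p) (≮⇒≥ p≮q)))

not-differ-by-one : ∀ X → ¬ ((+ X - + X ≡ + 1) ⊎ (+ X - + X ≡ - + 1))
not-differ-by-one X (inj₁ e) with trans (sym (i≡j⇒i-j≡0 {+ X} refl)) e
... | ()
not-differ-by-one X (inj₂ e) with trans (sym (i≡j⇒i-j≡0 {+ X} refl)) e
... | ()

sorted-singleton : ∀ {t v} → AllPairs _<_ t → (∀ r → r ∈ t → r ≡ v) → v ∈ t → t ≡ v ∷ []
sorted-singleton {w ∷ []} _ all-v _ = cong (_∷ []) (all-v w (here refl))
sorted-singleton {w ∷ x ∷ _} ((w<x ∷ _) ∷ _) all-v _ =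
  ⊥-elim (<-irrefl (trans (all-v w (here refl)) (sym (all-v x (there (here refl))))) w<x)

All-< : ∀ {x y : ℕ} {xs} → All (x <_) xs → y ∈ xs → x < y
All-< (x<y ∷ _) (here refl) = x<y
All-< (_ ∷ x<xs) (there y∈) = All-< x<xs y∈

sorted-pair : ∀ {xs u v} → AllPairs _<_ xs → (∀ r → r ∈ xs → r ≡ u ⊎ r ≡ v) → u ∈ xs → v ∈ xs → u < v →
  xs ≡ u ∷ v ∷ []
sorted-pair {h ∷ t} {u} {v} (h<t ∷ sorted-t) in-uv u∈ v∈ u<v with in-uv h (here refl)
... | inj₂ refl with u∈
...   | here u≡h = ⊥-elim (<-irrefl u≡h u<v)
...   | there u∈t = ⊥-elim (<-asym u<v (All-< h<t u∈t))
sorted-pair {h ∷ t} {u} {v} (h<t ∷ sorted-t) in-uv u∈ v∈ u<v | inj₁ refl with v∈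
... | here v≡h = ⊥-elim (<-irrefl (sym v≡h) u<v)
... | there v∈t = cong (h ∷_) (sorted-singleton sorted-t all-v v∈t)
  where
  all-v : ∀ r → r ∈ t → r ≡ v
  all-v r r∈t with in-uv r (there r∈t)
  ... | inj₁ refl = ⊥-elim (<-irrefl refl (All-< h<t r∈t))
  ... | inj₂ r≡v = r≡v

filter-cong : ∀ {P Q : Pred ℕ 0ℓ} (P? : Decidable P) (Q? : Decidable Q) xs →
  (∀ x → x ∈ xs → (P x → Q x) × (Q x → P x)) → filter P? xs ≡ filter Q? xs
filter-cong P? Q? [] _ = refl
filter-cong P? Q? (x ∷ xs) P⇔Q with P? x | Q? x
... | yes _ | yes _ = cong (x ∷_) (filter-cong P? Q? xs (λ y y∈ → P⇔Q y (there y∈)))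
... | yes p | no ¬q = ⊥-elim (¬q (proj₁ (P⇔Q x (here refl)) p))
... | no ¬p | yes q = ⊥-elim (¬p (proj₂ (P⇔Q x (here refl)) q))
... | no _ | no _ = filter-cong P? Q? xs (λ y y∈ → P⇔Q y (there y∈))

head0-∷ : ∀ {xs x ys} → xs ≡ x ∷ ys → head0 xs ≡ x
head0-∷ refl = refl

last0-pair : ∀ {xs x y} → xs ≡ x ∷ y ∷ [] → last0 xs ≡ y
last0-pair refl = refl

colRows-sorted : ∀ n C j → AllPairs _<_ (colRows n C j)
colRows-sorted n C j = AllPairsₚ.filter⁺ (λ r → C r ≟ j) (interval-sorted (2 * n))

∈-colRows⁺ : ∀ n C j r → InRange (2 * n) r → C r ≡ j → r ∈ colRows n C j
∈-colRows⁺ n C j r r∈ Cr≡j = ∈-filter⁺ (λ r → C r ≟ j) (∈-interval⁺ r∈) Cr≡j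

∈-colRows⁻ : ∀ n C j r → r ∈ colRows n C j → InRange (2 * n) r × C r ≡ j
∈-colRows⁻ n C j r r∈ = let (r∈L , Cr≡j) = ∈-filter⁻ (λ r → C r ≟ j) r∈ in ∈-interval⁻ r∈L , Cr≡j

colRows-cong : ∀ n C C' → (∀ r → C r ≡ C' r) → ∀ j → colRows n C j ≡ colRows n C' j
colRows-cong n C C' C≡C' j = filter-cong (λ r → C r ≟ j) (λ r → C' r ≟ j) (interval (2 * n))
  (λ r _ → trans (sym (C≡C' r)) , trans (C≡C' r))

record Column (n : ℕ) (C : Config) (j : ℕ) : Set where
  field
    lower<upper : i₁ n C j < i₂ n C j
    lower-row : InRange (2 * n) (i₁ n C j)
    upper-row : InRange (2 * n) (i₂ n C j)
    lower-col : C (i₁ n C j) ≡ j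
    upper-col : C (i₂ n C j) ≡ j
    only : ∀ r → InRange (2 * n) r → C r ≡ j → r ≡ i₁ n C j ⊎ r ≡ i₂ n C j

column : ∀ n C j → IsDC n C → InRange n j → Column n C j
column n C j dc j∈ with colRows n C j in rows-eq | colRows-sorted n C j | proj₂ dc j j∈
... | x ∷ y ∷ [] | (x<y ∷ []) ∷ _ | _ = record
  { lower<upper = subst₂ _<_ (sym i₁≡x) (sym i₂≡y) x<y
  ; lower-row = subst (InRange (2 * n)) (sym i₁≡x) (proj₁ x-in)
  ; upper-row = subst (InRange (2 * n)) (sym i₂≡y) (proj₁ y-in)
  ; lower-col = trans (cong C i₁≡x) (proj₂ x-in)
  ; upper-col = trans (cong C i₂≡y) (proj₂ y-in)
  ; only = λ r r∈ Cr≡j → either (subst (r ∈_) rows-eq (∈-colRows⁺ n C j r r∈ Cr≡j))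
  }
  where
  i₁≡x : i₁ n C j ≡ x
  i₁≡x = head0-∷ rows-eq
  i₂≡y : i₂ n C j ≡ y
  i₂≡y = last0-pair rows-eq
  x-in : InRange (2 * n) x × C x ≡ j
  x-in = ∈-colRows⁻ n C j x (subst (x ∈_) (sym rows-eq) (here refl))
  y-in : InRange (2 * n) y × C y ≡ j
  y-in = ∈-colRows⁻ n C j y (subst (y ∈_) (sym rows-eq) (there (here refl)))
  either : ∀ {r} → r ∈ x ∷ y ∷ [] → r ≡ i₁ n C j ⊎ r ≡ i₂ n C j
  either (here refl) = inj₁ (sym i₁≡x)
  either (there (here refl)) = inj₂ (sym i₂≡y)

isDC-cong : ∀ n C C' → (∀ r → C r ≡ C' r) → IsDC n C → IsDC n C'
isDC-cong n C C' C≡C' (rows , cols) =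
  (λ r r∈ → subst (λ c → InRange n c × c ≤ r × r ≤ c + n) (C≡C' r) (rows r r∈)) ,
  (λ j j∈ → trans (cong length (sym (colRows-cong n C C' C≡C' j))) (cols j j∈))

-- Arithmetic of the labels e_r and of positions and values in [2n+2].

2*-mono : ∀ {a b} → a ≤ b → 2 * a ≤ 2 * b
2*-mono = *-monoʳ-≤ 2

2*-cancel : ∀ {a b} → 2 * a ≤ 2 * b → a ≤ b
2*-cancel = *-cancelˡ-≤ 2

2*-injective : ∀ {a b} → 2 * a ≡ 2 * b → a ≡ b
2*-injective {a} {b} = *-cancelˡ-≡ a b 2

1+2*-injective : ∀ {a b} → suc (2 * a) ≡ suc (2 * b) → a ≡ b
1+2*-injective e = 2*-injective (suc-injective e)

2*-suc : ∀ a → 2 * suc a ≡ suc (suc (2 * a))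
2*-suc a = cong suc (+-suc a (a + 0))

2*-suc' : ∀ n → 2 * suc n ≡ 2 * n + 2
2*-suc' n = solve 1 (λ n → con 2 :* (con 1 :+ n) := con 2 :* n :+ con 2) refl n

even%2 : ∀ j → (2 * j) % 2 ≡ 0
even%2 j = trans (cong (_% 2) (*-comm 2 j)) (m*n%n≡0 j 2)

odd%2 : ∀ j → suc (2 * j) % 2 ≡ 1
odd%2 j = trans (cong (λ z → suc z % 2) (*-comm 2 j)) ([m+kn]%n≡m%n 1 j 2)

even/2 : ∀ j → (2 * j) / 2 ≡ j
even/2 j = trans (cong (_/ 2) (*-comm 2 j)) (m*n/n≡m j 2)

odd/2 : ∀ j → suc (2 * j) / 2 ≡ j
odd/2 j = trans (cong (λ z → suc z / 2) (*-comm 2 j))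
  (trans (+-distrib-/ 1 (j * 2) (subst (λ z → 1 + z < 2) (sym (m*n%n≡0 j 2)) (s≤s (s≤s z≤n)))) (m*n/n≡m j 2))

parity : ∀ x → Σ ℕ λ k → x ≡ 2 * k ⊎ x ≡ suc (2 * k)
parity zero = 0 , inj₁ refl
parity (suc x) with parity x
... | k , inj₁ refl = k , inj₂ refl
... | k , inj₂ refl = suc k , inj₁ (cong suc (sym (+-suc k (k + 0))))

lab-low : ∀ n r → r ≤ n → lab n r ≡ 2 * suc r
lab-low n r r≤n with r ≤? n
... | yes _ = solve 1 (λ r → con 2 :* r :+ con 2 := con 2 :* (con 1 :+ r)) refl r
... | no r≰n = ⊥-elim (r≰n r≤n)

lab-high : ∀ n r → n < r → lab n r ≡ suc (2 * (r ∸ suc n))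
lab-high n r n<r with r ≤? n
... | yes r≤n = ⊥-elim (<⇒≱ n<r r≤n)
... | no _ rewrite +-∸-assoc 1 n<r with r ∸ suc n
... | k = +-suc k (k + 0)

data LabelShape (n r : ℕ) : Set where
  low : r ≤ n → lab n r ≡ 2 * suc r → LabelShape n r
  high : n < r → lab n r ≡ suc (2 * (r ∸ suc n)) → LabelShape n r

labelShape : ∀ n r → LabelShape n r
labelShape n r with r ≤? n
... | yes r≤n = low r≤n (lab-low n r r≤n)
... | no r≰n = high (≰⇒> r≰n) (lab-high n r (≰⇒> r≰n))

high-row : ∀ n r → n < r → suc n + (r ∸ suc n) ≡ r
high-row n r n<r = m+[n∸m]≡n n<r

high-row-bound : ∀ n r j → n < r → r ≤ j + n → r ∸ suc n < j
high-row-bound n r j n<r r≤j+n = +-cancelˡ-≤ n (suc (r ∸ suc n)) j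
  (subst₂ _≤_ (trans (sym (high-row n r n<r)) (sym (+-suc n (r ∸ suc n)))) (+-comm j n) r≤j+n)

lab-injective : ∀ n x y → lab n x ≡ lab n y → x ≡ y
lab-injective n x y e with labelShape n x | labelShape n y
... | low _ ex | low _ ey = suc-injective (2*-injective (trans (sym ex) (trans e ey)))
... | low _ ex | high _ ey = ⊥-elim (even≢odd (suc x) (y ∸ suc n) (trans (sym ex) (trans e ey)))
... | high _ ex | low _ ey = ⊥-elim (even≢odd (suc y) (x ∸ suc n) (sym (trans (sym ex) (trans e ey))))
... | high n<x ex | high n<y ey =
  trans (sym (high-row n x n<x)) (trans (cong (λ k → suc n + k) (1+2*-injective (trans (sym ex) (trans e ey)))) (high-row n y n<y))

-- labels of rows avoid the two values 2 and 2n+1, which φ(C)⁻¹ takes at 1 and 2n+2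
lab≢2 : ∀ n r → 1 ≤ r → lab n r ≢ 2
lab≢2 n r 1≤r e with labelShape n r
... | low _ er = <⇒≢ (s≤s 1≤r) (sym (2*-injective {b = 1} (trans (sym er) e)))
... | high _ er = even≢odd 1 (r ∸ suc n) (sym (trans (sym er) e))

lab≢2n+1 : ∀ n r → r ≤ 2 * n → lab n r ≢ 2 * n + 1
lab≢2n+1 n r r≤2n e with labelShape n r
... | low _ er = even≢odd (suc r) n (trans (sym er) (trans e (+-comm (2 * n) 1)))
... | high n<r er = <-irrefl refl (≤-trans (subst (_≤ 2 * n) r≡ r≤2n) (≤-reflexive (cong (λ k → n + k) (+-identityʳ n))))
  where
  r≡ : r ≡ suc (n + n)
  r≡ = trans (sym (high-row n r n<r))
         (cong (λ k → suc n + k) (2*-injective (suc-injective (trans (sym er) (trans e (+-comm (2 * n) 1))))))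

lab-range : ∀ n r → InRange (2 * n) r → InRange (2 * n + 2) (lab n r)
lab-range n r (1≤r , r≤2n) with labelShape n r
... | low r≤n er rewrite er = ≤-trans (s≤s z≤n) (2*-mono (s≤s z≤n)) , subst (2 * suc r ≤_) (2*-suc' n) (2*-mono (s≤s r≤n))
... | high n<r er rewrite er =
  s≤s z≤n , ≤-trans (≤-trans (n≤1+n _) (subst (_≤ 2 * n) (2*-suc (r ∸ suc n)) (2*-mono k<n))) (m≤m+n (2 * n) 2)
  where
  k<n : r ∸ suc n < n
  k<n = high-row-bound n r n n<r (subst (r ≤_) (cong (λ k → n + k) (+-identityʳ n)) r≤2n)

-- the labels e_i, e_{i+1} of adjacent rows, read as the preimages of 2j and
-- 2j+1, never satisfy the normalisation condition
adjacent-labels-not-normalized : ∀ n i → 1 ≤ i →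
  ¬ (((lab n i % 2 ≡ lab n (suc i) % 2) → lab n (suc i) < lab n i) ×
     (lab n (suc i) < lab n i → lab n i % 2 ≡ lab n (suc i) % 2))
adjacent-labels-not-normalized n i 1≤i (same⇒> , >⇒same) with labelShape n i | labelShape n (suc i)
... | low _ e₁ | low _ e₂ rewrite e₁ | e₂ =
  <-asym (same⇒> (trans (even%2 (suc i)) (sym (even%2 (suc (suc i)))))) (*-monoʳ-< 2 (n<1+n (suc i)))
... | high n<i e₁ | high _ e₂ rewrite e₁ | e₂ =
  <-asym (same⇒> (trans (odd%2 (i ∸ suc n)) (sym (odd%2 (suc i ∸ suc n))))) (s≤s (*-monoʳ-< 2 (∸-monoˡ-< (n<1+n i) n<i)))
... | high n<i _ | low 1+i≤n _ = <-asym n<i (≤-trans (n<1+n i) 1+i≤n)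
... | low i≤n e₁ | high _ e₂ rewrite e₁ | e₂ =
  0≢1+n (trans (sym (even%2 (suc i))) (trans (>⇒same odd<even) (odd%2 (i ∸ n))))
  where
  odd<even : suc (2 * (i ∸ n)) < 2 * suc i
  odd<even rewrite m≤n⇒m∸n≡0 i≤n = ≤-trans (s≤s (s≤s z≤n)) (2*-mono (s≤s z≤n))

data Position (n x : ℕ) : Set where
  first : x ≡ 1 → Position n x
  last : x ≡ 2 * n + 2 → Position n x
  even : ∀ j → InRange n j → x ≡ 2 * j → Position n x
  odd : ∀ j → InRange n j → x ≡ suc (2 * j) → Position n x

position : ∀ n x → InRange (2 * n + 2) x → Position n x
position n x (1≤x , x≤) with parity x
... | zero , inj₁ refl = ⊥-elim (<-irrefl refl 1≤x)
... | zero , inj₂ refl = first refl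
... | suc k , inj₁ refl with suc k ≤? n
...   | yes 1+k≤n = even (suc k) (s≤s z≤n , 1+k≤n) refl
...   | no 1+k≰n = last (trans (cong (2 *_) k≡n) (2*-suc' n))
  where
  k≡n : suc k ≡ suc n
  k≡n = ≤-antisym (2*-cancel (subst (2 * suc k ≤_) (sym (2*-suc' n)) x≤)) (≰⇒> 1+k≰n)
position n x (1≤x , x≤) | suc k , inj₂ refl with suc k ≤? n
... | yes 1+k≤n = odd (suc k) (s≤s z≤n , 1+k≤n) refl
... | no 1+k≰n = ⊥-elim (<-irrefl refl (≤-trans (s≤s (2*-mono (≰⇒> 1+k≰n))) (subst (suc (2 * suc k) ≤_) (sym (2*-suc' n)) x≤)))

data Value (n y : ℕ) : Set where
  two : y ≡ 2 → Value n y
  top : y ≡ 2 * n + 1 → Value n y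
  label : ∀ r → InRange (2 * n) r → lab n r ≡ y → Value n y

value : ∀ n y → InRange (2 * n + 2) y → Value n y
value n y (1≤y , y≤) with parity y
... | zero , inj₁ refl = ⊥-elim (<-irrefl refl 1≤y)
... | suc zero , inj₁ refl = two refl
... | suc (suc r) , inj₁ refl = label (suc r) (s≤s z≤n , ≤-trans 1+r≤n (m≤m+n n (n + 0))) (lab-low n (suc r) 1+r≤n)
  where
  1+r≤n : suc r ≤ n
  1+r≤n = ≤-pred (2*-cancel (subst (2 * suc (suc r) ≤_) (sym (2*-suc' n)) y≤))
... | k , inj₂ refl with k <? n
...   | yes k<n = label (suc n + k) (s≤s z≤n , r≤2n)
                   (trans (lab-high n (suc n + k) (s≤s (m≤m+n n k))) (cong (λ z → suc (2 * z)) (m+n∸m≡n (suc n) k)))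
  where
  r≤2n : suc n + k ≤ 2 * n
  r≤2n = subst (suc n + k ≤_) (cong (λ k → n + k) (sym (+-identityʳ n))) (subst (_≤ n + n) (+-suc n k) (+-monoʳ-≤ n k<n))
...   | no k≮n = top (trans (cong suc (cong (2 *_) k≡n)) (+-comm 1 (2 * n)))
  where
  k≤n : k ≤ n
  k≤n = ≤-pred (*-cancelˡ-< 2 k (suc n) (subst (suc (2 * k) ≤_) (trans (+-comm (2 * n) 2) (sym (2*-suc n))) y≤))
  k≡n : k ≡ n
  k≡n = ≤-antisym k≤n (≮⇒≥ k≮n)

range-2+2n : ∀ n {x} → InRange (2 * suc n) x → InRange (2 * n + 2) x
range-2+2n n {x} = subst (λ N → InRange N x) (2*-suc' n)

range-2+2n⁻ : ∀ n {x} → InRange (2 * n + 2) x → InRange (2 * suc n) x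
range-2+2n⁻ n {x} = subst (λ N → InRange N x) (sym (2*-suc' n))

phiInv-last : ∀ n C → phiInv n C (2 * n + 2) ≡ 2 * n + 1
phiInv-last n C with 2 * n + 2 ≟ 1
... | yes e = ⊥-elim (0≢1+n (sym (suc-injective (trans (sym (+-comm (2 * n) 2)) e))))
... | no _ with 2 * n + 2 ≟ 2 * n + 2
...   | yes _ = refl
...   | no ≢refl = ⊥-elim (≢refl refl)

phiInv-even : ∀ n C j → InRange n j → phiInv n C (2 * j) ≡ lab n (i₂ n C j)
phiInv-even n C j (1≤j , j≤n) with 2 * j ≟ 1
... | yes e = ⊥-elim (even≢odd j 0 e)
... | no _ with 2 * j ≟ 2 * n + 2
...   | yes e = ⊥-elim (<-irrefl refl (subst (_≤ n) (2*-injective (trans e (sym (2*-suc' n)))) j≤n))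
...   | no _ with (2 * j) % 2 ≟ 0
...     | yes _ = cong (λ c → lab n (i₂ n C c)) (even/2 j)
...     | no ≢0 = ⊥-elim (≢0 (even%2 j))

phiInv-odd : ∀ n C j → InRange n j → phiInv n C (suc (2 * j)) ≡ lab n (i₁ n C j)
phiInv-odd n C j (1≤j , j≤n) with suc (2 * j) ≟ 1
... | yes e = ⊥-elim (<⇒≢ (≤-trans (s≤s z≤n) (2*-mono 1≤j)) (sym (suc-injective e)))
... | no _ with suc (2 * j) ≟ 2 * n + 2
...   | yes e = ⊥-elim (even≢odd (suc n) j (sym (trans e (sym (2*-suc' n)))))
...   | no _ with suc (2 * j) % 2 ≟ 0
...     | yes e = ⊥-elim (0≢1+n (trans (sym e) (odd%2 j)))
...     | no _ = cong (λ c → lab n (i₁ n C c)) (odd/2 j)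

phiInv-cong : ∀ n C C' → (∀ r → C r ≡ C' r) → ∀ x → phiInv n C x ≡ phiInv n C' x
phiInv-cong n C C' C≡C' x with x ≟ 1
... | yes _ = refl
... | no _ with x ≟ 2 * n + 2
...   | yes _ = refl
...   | no _ with x % 2 ≟ 0
...     | yes _ = cong (λ rows → lab n (last0 rows)) (colRows-cong n C C' C≡C' (x / 2))
...     | no _ = cong (λ rows → lab n (head0 rows)) (colRows-cong n C C' C≡C' (x / 2))

head0-filter : ∀ {P : Pred ℕ 0ℓ} (P? : Decidable P) xs x → x ∈ xs → P x →
  head0 (filter P? xs) ∈ xs × P (head0 (filter P? xs))
head0-filter P? (y ∷ ys) x x∈ px with P? y
... | yes py = here refl , py
head0-filter P? (y ∷ ys) x (here refl) px | no ¬py = ⊥-elim (¬py px)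
head0-filter P? (y ∷ ys) x (there x∈) px | no _ =
  let (h∈ , ph) = head0-filter P? ys x x∈ px in there h∈ , ph

invOn-preimage : ∀ N f x y → InRange N x → f x ≡ y → InRange N (invOn N f y) × f (invOn N f y) ≡ y
invOn-preimage N f x y x∈ fx≡y =
  let (h∈ , fh≡y) = head0-filter (λ z → f z ≟ y) (interval N) x (∈-interval⁺ x∈) fx≡y in ∈-interval⁻ h∈ , fh≡y

invOn-cong : ∀ N f f' y y' → (∀ x → InRange N x → (f x ≡ y → f' x ≡ y') × (f' x ≡ y' → f x ≡ y)) →
  invOn N f y ≡ invOn N f' y'
invOn-cong N f f' y y' same = cong head0 (filter-cong (λ z → f z ≟ y) (λ z → f' z ≟ y') (interval N)
  (λ x x∈ → same x (∈-interval⁻ x∈)))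

phi-cong : ∀ n C C' → (∀ r → C r ≡ C' r) → ∀ y → phi n C y ≡ phi n C' y
phi-cong n C C' C≡C' y = invOn-cong (2 * n + 2) (phiInv n C) (phiInv n C') y y
  (λ x _ → trans (sym (phiInv-cong n C C' C≡C' x)) , trans (phiInv-cong n C C' C≡C' x))

normalized-cong : ∀ m F G → (∀ y → InRange (2 * m) y → F y ≡ G y) →
  IsNormalizedDumont m F → IsNormalizedDumont m G
normalized-cong m F G F≡G (((range , injective) , dumont) , normal) =
  ((range' , injective') , dumont') , normal'
  where
  range' : ∀ x → InRange (2 * m) x → InRange (2 * m) (G x)
  range' x x∈ = subst (InRange (2 * m)) (F≡G x x∈) (range x x∈)
  injective' : ∀ x y → InRange (2 * m) x → InRange (2 * m) y → G x ≡ G y → x ≡ y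
  injective' x y x∈ y∈ e = injective x y x∈ y∈ (trans (F≡G x x∈) (trans e (sym (F≡G y y∈))))
  dumont' : ∀ i → 1 ≤ i → i ≤ m → (G (2 * i) < 2 * i) × (2 * i ∸ 1 < G (2 * i ∸ 1))
  dumont' (suc k) 1≤i i≤m = subst (_< 2 * suc k) (F≡G _ even∈) (proj₁ (dumont (suc k) 1≤i i≤m)) ,
                            subst (2 * suc k ∸ 1 <_) (F≡G _ odd∈) (proj₂ (dumont (suc k) 1≤i i≤m))
    where
    even∈ : InRange (2 * m) (2 * suc k)
    even∈ = ≤-trans (s≤s z≤n) (2*-mono (s≤s z≤n)) , 2*-mono i≤m
    odd∈ : InRange (2 * m) (2 * suc k ∸ 1)
    odd∈ = subst (InRange (2 * m)) (sym (cong (_∸ 1) (2*-suc k)))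
             (s≤s z≤n , ≤-trans (n≤1+n _) (subst (_≤ 2 * m) (2*-suc k) (2*-mono i≤m)))
  normal' : ∀ j → 1 ≤ j → j ≤ m ∸ 1 → ∀ a b → InRange (2 * m) a → InRange (2 * m) b →
    G a ≡ 2 * j → G b ≡ 2 * j + 1 → ((a % 2 ≡ b % 2 → b < a) × (b < a → a % 2 ≡ b % 2))
  normal' j 1≤j j≤m-1 a b a∈ b∈ Ga Gb = normal j 1≤j j≤m-1 a b a∈ b∈ (trans (F≡G a a∈) Ga) (trans (F≡G b b∈) Gb)

-- For a Dellac configuration D the map φ(D)⁻¹ = phiInv n D hits every value
-- of [2n+2], so phi n D is its inverse there; the shape constraints of D then
-- make phi n D a normalised Dumont permutation.
module PhiOfDellac (n : ℕ) (D : Config) (dc : IsDC n D) where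
  private
    N : ℕ
    N = 2 * n + 2

    1≤N : 1 ≤ N
    1≤N = ≤-trans (s≤s z≤n) (m≤n+m 2 (2 * n))

  col≤row : ∀ r → InRange (2 * n) r → D r ≤ r
  col≤row r r∈ = proj₁ (proj₂ (proj₁ dc r r∈))

  row≤col+n : ∀ r → InRange (2 * n) r → r ≤ D r + n
  row≤col+n r r∈ = proj₂ (proj₂ (proj₁ dc r r∈))

  phiInv-hits-label : ∀ r → InRange (2 * n) r → Σ ℕ λ x → InRange N x × phiInv n D x ≡ lab n r
  phiInv-hits-label r r∈ = [ at-lower , at-upper ] (Column.only (column n D j dc j∈) r r∈ refl)
    where
    j : ℕ
    j = D r
    j∈ : InRange n j
    j∈ = proj₁ (proj₁ dc r r∈)
    at-lower : r ≡ i₁ n D j → Σ ℕ λ x → InRange N x × phiInv n D x ≡ lab n r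
    at-lower r≡lower = suc (2 * j) , (s≤s z≤n , odd≤N) , trans (phiInv-odd n D j j∈) (cong (lab n) (sym r≡lower))
      where
      odd≤N : suc (2 * j) ≤ N
      odd≤N = ≤-trans (n≤1+n _) (subst (suc (suc (2 * j)) ≤_) (+-comm 2 (2 * n)) (s≤s (s≤s (2*-mono (proj₂ j∈)))))
    at-upper : r ≡ i₂ n D j → Σ ℕ λ x → InRange N x × phiInv n D x ≡ lab n r
    at-upper r≡upper = 2 * j , (≤-trans (s≤s z≤n) (2*-mono (proj₁ j∈)) , even≤N) , trans (phiInv-even n D j j∈) (cong (lab n) (sym r≡upper))
      where
      even≤N : 2 * j ≤ N
      even≤N = ≤-trans (2*-mono (proj₂ j∈)) (m≤m+n (2 * n) 2)

  phiInv-surjective : ∀ y → InRange N y → Σ ℕ λ x → InRange N x × phiInv n D x ≡ y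
  phiInv-surjective y y∈ with value n y y∈
  ... | two refl = 1 , (≤-refl , 1≤N) , refl
  ... | top refl = N , (1≤N , ≤-refl) , phiInv-last n D
  ... | label r r∈ refl = phiInv-hits-label r r∈

  data PhiInvAt (x : ℕ) : Set where
    at-first : x ≡ 1 → phiInv n D x ≡ 2 → PhiInvAt x
    at-last : x ≡ N → phiInv n D x ≡ 2 * n + 1 → PhiInvAt x
    at-even : ∀ j → x ≡ 2 * j → Column n D j → phiInv n D x ≡ lab n (i₂ n D j) → PhiInvAt x
    at-odd : ∀ j → x ≡ suc (2 * j) → Column n D j → phiInv n D x ≡ lab n (i₁ n D j) → PhiInvAt x

  phiInvAt : ∀ x → InRange N x → PhiInvAt x
  phiInvAt x x∈ with position n x x∈
  ... | first refl = at-first refl refl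
  ... | last refl = at-last refl (phiInv-last n D)
  ... | even j j∈ refl = at-even j refl (column n D j dc j∈) (phiInv-even n D j j∈)
  ... | odd j j∈ refl = at-odd j refl (column n D j dc j∈) (phiInv-odd n D j j∈)

  phiInv-at-label : ∀ x → InRange N x → ∀ r → InRange (2 * n) r → phiInv n D x ≡ lab n r →
    (x ≡ 2 * D r × r ≡ i₂ n D (D r)) ⊎ (x ≡ suc (2 * D r) × r ≡ i₁ n D (D r))
  phiInv-at-label x x∈ r r∈ gx≡ with phiInvAt x x∈
  ... | at-first _ g≡2 = ⊥-elim (lab≢2 n r (proj₁ r∈) (trans (sym gx≡) g≡2))
  ... | at-last _ g≡top = ⊥-elim (lab≢2n+1 n r (proj₂ r∈) (trans (sym gx≡) g≡top))
  ... | at-even j refl col g≡ = inj₁ (cong (2 *_) (sym Dr≡j) , subst (λ c → r ≡ i₂ n D c) (sym Dr≡j) r≡upper)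
    where
    r≡upper : r ≡ i₂ n D j
    r≡upper = lab-injective n r _ (trans (sym gx≡) g≡)
    Dr≡j : D r ≡ j
    Dr≡j = trans (cong D r≡upper) (Column.upper-col col)
  ... | at-odd j refl col g≡ = inj₂ (cong (λ c → suc (2 * c)) (sym Dr≡j) , subst (λ c → r ≡ i₁ n D c) (sym Dr≡j) r≡lower)
    where
    r≡lower : r ≡ i₁ n D j
    r≡lower = lab-injective n r _ (trans (sym gx≡) g≡)
    Dr≡j : D r ≡ j
    Dr≡j = trans (cong D r≡lower) (Column.lower-col col)

  phi-preimage : ∀ y → InRange N y → InRange N (phi n D y) × phiInv n D (phi n D y) ≡ y
  phi-preimage y y∈ = let (x , x∈ , gx≡y) = phiInv-surjective y y∈ in invOn-preimage N (phiInv n D) x y x∈ gx≡y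

  phi-upper : ∀ j → InRange n j → phi n D (lab n (i₂ n D j)) ≡ 2 * j
  phi-upper j j∈ = [ (λ { (x≡ , _) → trans x≡ (cong (2 *_) (Column.upper-col col)) }) ,
                     (λ { (_ , r≡) → ⊥-elim (<-irrefl (sym (trans r≡ (cong (i₁ n D) (Column.upper-col col)))) (Column.lower<upper col)) }) ]
                   (phiInv-at-label _ (proj₁ pre) (i₂ n D j) (Column.upper-row col) (proj₂ pre))
    where
    col : Column n D j
    col = column n D j dc j∈
    pre : InRange N (phi n D (lab n (i₂ n D j))) × phiInv n D (phi n D (lab n (i₂ n D j))) ≡ lab n (i₂ n D j)
    pre = phi-preimage _ (lab-range n _ (Column.upper-row col))

  phi-lower : ∀ j → InRange n j → phi n D (lab n (i₁ n D j)) ≡ suc (2 * j)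
  phi-lower j j∈ = [ (λ { (_ , r≡) → ⊥-elim (<-irrefl (trans r≡ (cong (i₂ n D) (Column.lower-col col))) (Column.lower<upper col)) }) ,
                     (λ { (x≡ , _) → trans x≡ (cong (λ c → suc (2 * c)) (Column.lower-col col)) }) ]
                   (phiInv-at-label _ (proj₁ pre) (i₁ n D j) (Column.lower-row col) (proj₂ pre))
    where
    col : Column n D j
    col = column n D j dc j∈
    pre : InRange N (phi n D (lab n (i₁ n D j))) × phiInv n D (phi n D (lab n (i₁ n D j))) ≡ lab n (i₁ n D j)
    pre = phi-preimage _ (lab-range n _ (Column.lower-row col))

  -- Dumont condition at even values: φ(D)⁻¹(x) = 2k forces x < 2k, since a
  -- dot in column j lies in a row r ≥ j
  phiInv-even-value : ∀ x → InRange N x → ∀ k → phiInv n D x ≡ 2 * k → x < 2 * k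
  phiInv-even-value x x∈ k gx≡ with phiInvAt x x∈
  ... | at-first refl g≡ = subst (1 <_) (trans (sym g≡) gx≡) (s≤s (s≤s z≤n))
  ... | at-last _ g≡ = ⊥-elim (even≢odd k n (trans (sym gx≡) (trans g≡ (+-comm (2 * n) 1))))
  ... | at-even j refl col g≡ with labelShape n (i₂ n D j)
  ...   | low _ e = subst (2 * j <_) (trans (sym e) (trans (sym g≡) gx≡))
                      (*-monoʳ-< 2 (s≤s (subst (_≤ i₂ n D j) (Column.upper-col col) (col≤row _ (Column.upper-row col)))))
  ...   | high _ e = ⊥-elim (even≢odd k (i₂ n D j ∸ suc n) (trans (sym gx≡) (trans g≡ e)))
  phiInv-even-value x x∈ k gx≡ | at-odd j refl col g≡ with labelShape n (i₁ n D j)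
  ...   | low _ e = subst (suc (2 * j) <_) (trans (sym (2*-suc (i₁ n D j))) (trans (sym e) (trans (sym g≡) gx≡)))
                      (s≤s (s≤s (2*-mono (subst (_≤ i₁ n D j) (Column.lower-col col) (col≤row _ (Column.lower-row col))))))
  ...   | high _ e = ⊥-elim (even≢odd k (i₁ n D j ∸ suc n) (trans (sym gx≡) (trans g≡ e)))

  -- Dumont condition at odd values: φ(D)⁻¹(x) = 2k+1 forces x > 2k+1, since a
  -- dot in column j lies in a row r ≤ j + n
  phiInv-odd-value : ∀ x → InRange N x → ∀ k → phiInv n D x ≡ suc (2 * k) → suc (2 * k) < x
  phiInv-odd-value x x∈ k gx≡ with phiInvAt x x∈
  ... | at-first refl g≡ = ⊥-elim (even≢odd 1 k (trans (sym g≡) gx≡))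
  ... | at-last refl g≡ = subst (_< N) (trans (sym g≡) gx≡) (subst (2 * n + 1 <_) (sym (+-suc (2 * n) 1)) ≤-refl)
  ... | at-even j refl col g≡ with labelShape n (i₂ n D j)
  ...   | low _ e = ⊥-elim (even≢odd (suc (i₂ n D j)) k (trans (sym e) (trans (sym g≡) gx≡)))
  ...   | high n<r e = subst (λ c → suc (2 * c) < 2 * j) (1+2*-injective {i₂ n D j ∸ suc n} {k} (trans (sym e) (trans (sym g≡) gx≡)))
                         (subst (_≤ 2 * j) (2*-suc (i₂ n D j ∸ suc n)) (2*-mono (high-row-bound n (i₂ n D j) j n<r
                           (subst (λ c → i₂ n D j ≤ c + n) (Column.upper-col col) (row≤col+n _ (Column.upper-row col))))))
  phiInv-odd-value x x∈ k gx≡ | at-odd j refl col g≡ with labelShape n (i₁ n D j)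
  ...   | low _ e = ⊥-elim (even≢odd (suc (i₁ n D j)) k (trans (sym e) (trans (sym g≡) gx≡)))
  ...   | high n<r e = subst (λ c → suc (2 * c) < suc (2 * j)) (1+2*-injective {i₁ n D j ∸ suc n} {k} (trans (sym e) (trans (sym g≡) gx≡)))
                         (s≤s (*-monoʳ-< 2 (high-row-bound n (i₁ n D j) j n<r
                           (subst (λ c → i₁ n D j ≤ c + n) (Column.lower-col col) (row≤col+n _ (Column.lower-row col))))))

  column-normalized : ∀ j → InRange n j →
    let A = lab n (i₂ n D j) ; B = lab n (i₁ n D j) in
    (A % 2 ≡ B % 2 → B < A) × (B < A → A % 2 ≡ B % 2)
  column-normalized j j∈ with column n D j dc j∈
  ... | col with labelShape n (i₁ n D j) | labelShape n (i₂ n D j)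
  ...   | low _ e₁ | low _ e₂ rewrite e₁ | e₂ =
          (λ _ → *-monoʳ-< 2 (s≤s (Column.lower<upper col))) ,
          (λ _ → trans (even%2 (suc (i₂ n D j))) (sym (even%2 (suc (i₁ n D j)))))
  ...   | high n<r₁ e₁ | high _ e₂ rewrite e₁ | e₂ =
          (λ _ → s≤s (*-monoʳ-< 2 (∸-monoˡ-< (Column.lower<upper col) n<r₁))) ,
          (λ _ → trans (odd%2 (i₂ n D j ∸ suc n)) (sym (odd%2 (i₁ n D j ∸ suc n))))
  ...   | high n<r₁ _ | low r₂≤n _ = ⊥-elim (<-asym (Column.lower<upper col) (≤-<-trans r₂≤n n<r₁))
  ...   | low _ e₁ | high n<r₂ e₂ rewrite e₁ | e₂ =
          (λ same → ⊥-elim (0≢1+n (trans (sym (even%2 (suc (i₁ n D j)))) (trans (sym same) (odd%2 (i₂ n D j ∸ suc n)))))) ,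
          (λ B<A → ⊥-elim (<-asym B<A A<B))
    where
    k<j : i₂ n D j ∸ suc n < j
    k<j = high-row-bound n (i₂ n D j) j n<r₂
            (subst (λ c → i₂ n D j ≤ c + n) (Column.upper-col col) (row≤col+n _ (Column.upper-row col)))
    j≤r₁ : j ≤ i₁ n D j
    j≤r₁ = subst (_≤ i₁ n D j) (Column.lower-col col) (col≤row _ (Column.lower-row col))
    A<B : suc (2 * (i₂ n D j ∸ suc n)) < 2 * suc (i₁ n D j)
    A<B = subst (_≤ 2 * suc (i₁ n D j)) (2*-suc _) (2*-mono (s≤s (≤-trans (<⇒≤ k<j) j≤r₁)))

  phi-normalized : IsNormalizedDumont (suc n) (phi n D)
  phi-normalized = (permutation , dumont) , normal
    where
    permutation : IsPerm (2 * suc n) (phi n D)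
    permutation =
      (λ y y∈ → range-2+2n⁻ n (proj₁ (phi-preimage y (range-2+2n n y∈)))) ,
      (λ y y' y∈ y'∈ e → trans (sym (proj₂ (phi-preimage y (range-2+2n n y∈))))
                            (trans (cong (phiInv n D) e) (proj₂ (phi-preimage y' (range-2+2n n y'∈)))))
    dumont : ∀ i → 1 ≤ i → i ≤ suc n → (phi n D (2 * i) < 2 * i) × (2 * i ∸ 1 < phi n D (2 * i ∸ 1))
    dumont (suc k) _ i≤ = even-ok , odd-ok
      where
      even∈ : InRange N (2 * suc k)
      even∈ = range-2+2n n (≤-trans (s≤s z≤n) (2*-mono (s≤s z≤n)) , 2*-mono i≤)
      odd∈ : InRange N (suc (2 * k))
      odd∈ = s≤s z≤n , ≤-trans (n≤1+n _) (subst (_≤ N) (2*-suc k) (proj₂ even∈))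
      even-ok : phi n D (2 * suc k) < 2 * suc k
      even-ok = let (x∈ , gx≡) = phi-preimage _ even∈ in phiInv-even-value _ x∈ (suc k) gx≡
      odd-ok : 2 * suc k ∸ 1 < phi n D (2 * suc k ∸ 1)
      odd-ok rewrite cong (_∸ 1) (2*-suc k) = let (x∈ , gx≡) = phi-preimage _ odd∈ in phiInv-odd-value _ x∈ k gx≡
    normal : ∀ j → 1 ≤ j → j ≤ suc n ∸ 1 → ∀ a b → InRange (2 * suc n) a → InRange (2 * suc n) b →
      phi n D a ≡ 2 * j → phi n D b ≡ 2 * j + 1 → ((a % 2 ≡ b % 2 → b < a) × (b < a → a % 2 ≡ b % 2))
    normal j 1≤j j≤n a b a∈ b∈ φa φb =
      subst₂ (λ u v → (u % 2 ≡ v % 2 → v < u) × (v < u → u % 2 ≡ v % 2)) (sym a≡) (sym b≡) (column-normalized j (1≤j , j≤n))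
      where
      a≡ : a ≡ lab n (i₂ n D j)
      a≡ = trans (sym (proj₂ (phi-preimage a (range-2+2n n a∈)))) (trans (cong (phiInv n D) φa) (phiInv-even n D j (1≤j , j≤n)))
      b≡ : b ≡ lab n (i₁ n D j)
      b≡ = trans (sym (proj₂ (phi-preimage b (range-2+2n n b∈))))
             (trans (cong (phiInv n D) (trans φb (+-comm (2 * j) 1))) (phiInv-odd n D j (1≤j , j≤n)))

-- φ under the switch Sw^i.

-- The transposition τ = (e_i, e_{i+1}) of labels acts on labels as s = (i, i+1)
-- acts on rows, and fixes the two values 2 and 2n+1 that are not labels.
module LabelSwap (n i : ℕ) (1≤i : 1 ≤ i) (1+i≤2n : suc i ≤ 2 * n) where
  open AdjacentSwap i

  τ : ℕ → ℕ
  τ = swap (lab n i) (lab n (suc i))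

  eᵢ≢eᵢ₊₁ : lab n i ≢ lab n (suc i)
  eᵢ≢eᵢ₊₁ e = i≢1+i (lab-injective n i (suc i) e)

  τ-injective : ∀ x y → τ x ≡ τ y → x ≡ y
  τ-injective x y e =
    trans (sym (swap-involutive _ _ x eᵢ≢eᵢ₊₁)) (trans (cong τ e) (swap-involutive _ _ y eᵢ≢eᵢ₊₁))

  i∈ : InRange (2 * n) i
  i∈ = 1≤i , ≤-trans (n≤1+n i) 1+i≤2n

  1+i∈ : InRange (2 * n) (suc i)
  1+i∈ = s≤s z≤n , 1+i≤2n

  s-range : ∀ r → InRange (2 * n) r → InRange (2 * n) (s r)
  s-range r r∈ with swapView i (suc i) r
  ... | at-a refl = subst (InRange (2 * n)) (sym s-i) 1+i∈
  ... | at-b refl = subst (InRange (2 * n)) (sym s-1+i) i∈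
  ... | elsewhere r≢i r≢1+i = subst (InRange (2 * n)) (sym (swap-other i (suc i) r r≢i r≢1+i)) r∈

  τ-lab : ∀ r → τ (lab n r) ≡ lab n (s r)
  τ-lab r with swapView i (suc i) r
  ... | at-a refl = trans (swap-left (lab n r) (lab n (suc r))) (cong (lab n) (sym s-i))
  ... | at-b refl = trans (swap-right (lab n i) (lab n (suc i)) eᵢ≢eᵢ₊₁) (cong (lab n) (sym s-1+i))
  ... | elsewhere r≢i r≢1+i =
    trans (swap-other _ _ (lab n r) (r≢i ∘ lab-injective n r i) (r≢1+i ∘ lab-injective n r (suc i)))
          (cong (lab n) (sym (swap-other i (suc i) r r≢i r≢1+i)))

  τ-2 : τ 2 ≡ 2
  τ-2 = swap-other _ _ 2 (λ e → lab≢2 n i 1≤i (sym e)) (λ e → lab≢2 n (suc i) (s≤s z≤n) (sym e))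

  τ-2n+1 : τ (2 * n + 1) ≡ 2 * n + 1
  τ-2n+1 = swap-other _ _ _ (λ e → lab≢2n+1 n i (proj₂ i∈) (sym e)) (λ e → lab≢2n+1 n (suc i) 1+i≤2n (sym e))

-- When the dots e_i, e_{i+1} of C lie in different columns and D = Sw^i C is
-- a Dellac configuration, each column of C is the s-image of the same column
-- of D with its two rows in the same order; hence φ(D) = φ(C)∘τ.
-- (D is taken as a parameter, given by its defining equation, so that the
-- proofs below never unfold it.)
module SwitchDistinctColumns (n i : ℕ) (1≤i : 1 ≤ i) (1+i≤2n : suc i ≤ 2 * n) (C D : Config)
  (D≡Sw : ∀ r → D r ≡ Sw i C r) (dc : IsDC n D) (distinct : C i ≢ C (suc i)) where
  open AdjacentSwap i
  open LabelSwap n i 1≤i 1+i≤2n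

  colRows-unswap : ∀ j → InRange n j → colRows n C j ≡ s (i₁ n D j) ∷ s (i₂ n D j) ∷ []
  colRows-unswap j j∈ = sorted-pair (colRows-sorted n C j) in-column
    (∈-colRows⁺ n C j _ (s-range _ (Column.lower-row col)) (trans (sym (D≡Sw _)) (Column.lower-col col)))
    (∈-colRows⁺ n C j _ (s-range _ (Column.upper-row col)) (trans (sym (D≡Sw _)) (Column.upper-col col)))
    (swap-preserves-< _ _ (Column.lower<upper col) not-i-and-1+i)
    where
    open ≡-Reasoning
    col : Column n D j
    col = column n D j dc j∈
    in-column : ∀ r → r ∈ colRows n C j → r ≡ s (i₁ n D j) ⊎ r ≡ s (i₂ n D j)
    in-column r r∈ with ∈-colRows⁻ n C j r r∈
    ... | r∈2n , Cr≡j with Column.only col (s r) (s-range r r∈2n) (trans (D≡Sw (s r)) (trans (cong C (s-involutive r)) Cr≡j))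
    ...   | inj₁ sr≡ = inj₁ (trans (sym (s-involutive r)) (cong s sr≡))
    ...   | inj₂ sr≡ = inj₂ (trans (sym (s-involutive r)) (cong s sr≡))
    not-i-and-1+i : ¬ (i₁ n D j ≡ i × i₂ n D j ≡ suc i)
    not-i-and-1+i (lower≡i , upper≡1+i) = distinct (begin
      C i           ≡⟨ cong C (sym s-1+i) ⟩
      C (s (suc i)) ≡⟨ sym (D≡Sw (suc i)) ⟩
      D (suc i)     ≡⟨ cong D (sym upper≡1+i) ⟩
      D (i₂ n D j)  ≡⟨ Column.upper-col col ⟩
      j             ≡⟨ sym (Column.lower-col col) ⟩
      D (i₁ n D j)  ≡⟨ cong D lower≡i ⟩
      D i           ≡⟨ D≡Sw i ⟩
      C (s i)       ≡⟨ cong C s-i ⟩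
      C (suc i)     ∎)

  phiInv-unswap : ∀ x → InRange (2 * n + 2) x → phiInv n C x ≡ τ (phiInv n D x)
  phiInv-unswap x x∈ with position n x x∈
  ... | first refl = sym τ-2
  ... | last refl = trans (phiInv-last n C) (sym (trans (cong τ (phiInv-last n D)) τ-2n+1))
  ... | even j j∈ refl = trans (phiInv-even n C j j∈) (trans (cong (lab n) (last0-pair (colRows-unswap j j∈)))
                           (sym (trans (cong τ (phiInv-even n D j j∈)) (τ-lab (i₂ n D j)))))
  ... | odd j j∈ refl = trans (phiInv-odd n C j j∈) (trans (cong (lab n) (head0-∷ (colRows-unswap j j∈)))
                          (sym (trans (cong τ (phiInv-odd n D j j∈)) (τ-lab (i₁ n D j)))))

  phi-unswap : ∀ y → phi n D y ≡ phi n C (τ y)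
  phi-unswap y = invOn-cong (2 * n + 2) (phiInv n D) (phiInv n C) y (τ y)
    (λ x x∈ → (λ gx≡y → trans (phiInv-unswap x x∈) (cong τ gx≡y)) ,
              (λ gx≡τy → τ-injective _ y (trans (sym (phiInv-unswap x x∈)) gx≡τy)))

module Switch (n : ℕ) (σ : ℕ → ℕ) (i : ℕ) (1≤i : 1 ≤ i) (1+i≤2n : suc i ≤ 2 * n)
  (switchable : Switchable n (varphi n σ) i) where
  open AdjacentSwap i
  open LabelSwap n i 1≤i 1+i≤2n

  C D C' : Config
  C = varphi n σ
  D = Sw i C
  C' = varphi n (σ ∘' τ)

  -- the five statements of the proposition, spelled out exactly as in its
  -- statement (through the abbreviations C, C', τ, Agda would compare them
  -- with the statement only after unfolding φ)
  P₁ P₂ P₃ P₄ P₅ : Set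
  P₁ = ¬ ConfEq n (varphi n (σ ∘' swap (lab n i) (lab n (suc i)))) (varphi n σ)
  P₂ = ¬ varphi n σ i ≡ varphi n σ (suc i)
  P₃ = (+ inv n (varphi n (σ ∘' swap (lab n i) (lab n (suc i)))) - + inv n (varphi n σ) ≡ + 1)
     ⊎ (+ inv n (varphi n (σ ∘' swap (lab n i) (lab n (suc i)))) - + inv n (varphi n σ) ≡ - + 1)
  P₄ = IsNormalizedDumont (suc n) (phi n (varphi n σ) ∘' swap (lab n i) (lab n (suc i)))
  P₅ = PermEq (2 * n + 2) (phi n (varphi n (σ ∘' swap (lab n i) (lab n (suc i)))))
                          (phi n (varphi n σ) ∘' swap (lab n i) (lab n (suc i)))

  -- φ(σ∘τ) = Sw^i φ(σ), because τ(e_r) = e_{s(r)}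
  C'≡D : ∀ r → C' r ≡ D r
  C'≡D r = cong (λ e → σ e / 2) (τ-lab r)

  module SameColumn (same : C i ≡ C (suc i)) where
    C≡D : ∀ r → C r ≡ D r
    C≡D r with swapView i (suc i) r
    ... | at-a refl = trans same (cong C (sym s-i))
    ... | at-b refl = trans (sym same) (cong C (sym s-1+i))
    ... | elsewhere r≢i r≢1+i = cong C (sym (swap-other i (suc i) r r≢i r≢1+i))

    C'≡C : ∀ r → C' r ≡ C r
    C'≡C r = trans (C'≡D r) (sym (C≡D r))

    configs-agree : ¬ P₁
    configs-agree differ = differ (λ r _ → C'≡C r)

    inv-unchanged : ¬ P₃
    inv-unchanged = not-differ-by-one (inv n C) ∘ subst (λ v → (+ v - + inv n C ≡ + 1) ⊎ (+ v - + inv n C ≡ - + 1)) same-inv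
      where
      same-inv : inv n C' ≡ inv n C
      same-inv = trans (inv≡invSum n C') (trans (invSum-cong (2 * n) C' C C'≡C) (sym (inv≡invSum n C)))

    private
      dc : IsDC n C
      dc = isDC-cong n D C (λ r → sym (C≡D r)) switchable
      j : ℕ
      j = C i
      j∈ : InRange n j
      j∈ = proj₁ (proj₁ dc i i∈)
      col : Column n C j
      col = column n C j dc j∈

    rows-of-column : i ≡ i₁ n C j × suc i ≡ i₂ n C j
    rows-of-column with Column.only col i i∈ refl | Column.only col (suc i) 1+i∈ (sym same)
    ... | inj₁ i≡lower | inj₂ 1+i≡upper = i≡lower , 1+i≡upper
    ... | inj₁ i≡lower | inj₁ 1+i≡lower = ⊥-elim (i≢1+i (trans i≡lower (sym 1+i≡lower)))
    ... | inj₂ i≡upper | inj₂ 1+i≡upper = ⊥-elim (i≢1+i (trans i≡upper (sym 1+i≡upper)))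
    ... | inj₂ i≡upper | inj₁ 1+i≡lower =
          ⊥-elim (<-asym (Column.lower<upper col) (subst₂ _<_ i≡upper 1+i≡lower (n<1+n i)))

    phi-i : phi n C (lab n i) ≡ suc (2 * j)
    phi-i = subst (λ r → phi n C (lab n r) ≡ suc (2 * j)) (sym (proj₁ rows-of-column)) (PhiOfDellac.phi-lower n C dc j j∈)

    phi-1+i : phi n C (lab n (suc i)) ≡ 2 * j
    phi-1+i = subst (λ r → phi n C (lab n r) ≡ 2 * j) (sym (proj₂ rows-of-column)) (PhiOfDellac.phi-upper n C dc j j∈)

    -- φ(C)∘τ sends e_i to 2j and e_{i+1} to 2j+1, which the labels cannot normalise
    not-normalized : ¬ P₄
    not-normalized (_ , normal) = adjacent-labels-not-normalized n i 1≤i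
      (normal j (proj₁ j∈) (proj₂ j∈) (lab n i) (lab n (suc i))
        (range-2+2n⁻ n (lab-range n i i∈)) (range-2+2n⁻ n (lab-range n (suc i) 1+i∈))
        (trans (cong (phi n C) (swap-left (lab n i) (lab n (suc i)))) phi-1+i)
        (trans (cong (phi n C) (swap-right (lab n i) (lab n (suc i)) eᵢ≢eᵢ₊₁)) (trans phi-i (+-comm 1 (2 * j)))))

    -- φ(C') = φ(C) would have to send e_i to both 2j+1 and 2j
    phi-not-swapped : ¬ P₅
    phi-not-swapped swapped = <-irrefl (sym (begin
      suc (2 * j)                   ≡⟨ sym phi-i ⟩
      phi n C (lab n i)             ≡⟨ sym (phi-cong n C' C C'≡C (lab n i)) ⟩
      phi n C' (lab n i)            ≡⟨ swapped (lab n i) (lab-range n i i∈) ⟩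
      phi n C (τ (lab n i))         ≡⟨ cong (phi n C) (swap-left (lab n i) (lab n (suc i))) ⟩
      phi n C (lab n (suc i))       ≡⟨ phi-1+i ⟩
      2 * j                         ∎)) (n<1+n (2 * j))
      where open ≡-Reasoning

  module DistinctColumns (distinct : ¬ C i ≡ C (suc i)) where
    open SwitchDistinctColumns n i 1≤i 1+i≤2n C D (λ _ → refl) switchable distinct

    configs-differ : P₁
    configs-differ agree = distinct (sym (trans (sym (trans (C'≡D i) (cong C s-i))) (agree i i∈)))

    inv-differs-by-one : P₃
    inv-differs-by-one =
      subst₂ (λ a b → (+ a - + b ≡ + 1) ⊎ (+ a - + b ≡ - + 1))
        (sym (trans (inv≡invSum n C') (invSum-cong (2 * n) C' D C'≡D))) (sym (inv≡invSum n C))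
        (differ-by-one (invSum (2 * n) D) (invSum (2 * n) C) (D i) (D (suc i)) D-distinct
          (trans (InversionSwap.inversion-swap (2 * n) i 1≤i 1+i≤2n D)
                 (cong (_+ indicator (D (suc i) <? D i)) (invSum-cong (2 * n) (D ∘ s) C (cong C ∘ s-involutive)))))
      where
      D-distinct : D i ≢ D (suc i)
      D-distinct e = distinct (sym (trans (cong C (sym s-i)) (trans e (cong C s-1+i))))

    phi-swapped : P₅
    phi-swapped y _ = trans (phi-cong n C' D C'≡D y) (phi-unswap y)

    normalized : P₄
    normalized = normalized-cong (suc n) (phi n D) (phi n C ∘' τ) (λ y _ → phi-unswap y)
                   (PhiOfDellac.phi-normalized n D switchable)

  equivalent-by-cases : ∀ {A B : Set} → (P₂ → A) → (C i ≡ C (suc i) → ¬ A) →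
    (P₂ → B) → (C i ≡ C (suc i) → ¬ B) → A ⇔ B
  equivalent-by-cases yes-A no-A yes-B no-B =
    mk⇔ (λ a → by-cases yes-B (λ same → ⊥-elim (no-A same a)))
        (λ b → by-cases yes-A (λ same → ⊥-elim (no-B same b)))
    where
    by-cases : ∀ {X : Set} → (P₂ → X) → (C i ≡ C (suc i) → X) → X
    by-cases distinct-case same-case with C i ≟ C (suc i)
    ... | yes same = same-case same
    ... | no distinct = distinct-case distinct

  same-column-fails : C i ≡ C (suc i) → ¬ P₂
  same-column-fails same distinct = distinct same

1+i≤2n : ∀ n i → 1 ≤ n → i ≤ 2 * n ∸ 1 → suc i ≤ 2 * n
1+i≤2n n i 1≤n i≤2n-1 = subst (suc i ≤_) (trans (+-comm 1 (2 * n ∸ 1)) (m∸n+n≡m (≤-trans (s≤s z≤n) (2*-mono 1≤n)))) (s≤s i≤2n-1)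

proposition5 : (n : ℕ) → 1 ≤ n → (σ : ℕ → ℕ) → IsDumont (suc n) σ →
  (i : ℕ) → 1 ≤ i → i ≤ 2 * n ∸ 1 →
  Switchable n (varphi n σ) i →
  let τ = swap (lab n i) (lab n (suc i))
      σ' = σ ∘' τ
  in ((¬ ConfEq n (varphi n σ') (varphi n σ))
        ⇔ (¬ varphi n σ i ≡ varphi n σ (suc i)))
   × ((¬ varphi n σ i ≡ varphi n σ (suc i))
        ⇔ ((+ inv n (varphi n σ') - + inv n (varphi n σ) ≡ + 1)
           ⊎ (+ inv n (varphi n σ') - + inv n (varphi n σ) ≡ - + 1)))
   × (((+ inv n (varphi n σ') - + inv n (varphi n σ) ≡ + 1)
           ⊎ (+ inv n (varphi n σ') - + inv n (varphi n σ) ≡ - + 1))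
        ⇔ IsNormalizedDumont (suc n) (phi n (varphi n σ) ∘' τ))
   × (IsNormalizedDumont (suc n) (phi n (varphi n σ) ∘' τ)
        ⇔ PermEq (2 * n + 2) (phi n (varphi n σ')) (phi n (varphi n σ) ∘' τ))
proposition5 n 1≤n σ _ i 1≤i i≤2n-1 switchable =
    equivalent-by-cases configs-differ configs-agree id same-column-fails
  , equivalent-by-cases id same-column-fails inv-differs-by-one inv-unchanged
  , equivalent-by-cases inv-differs-by-one inv-unchanged normalized not-normalized
  , equivalent-by-cases normalized not-normalized phi-swapped phi-not-swapped
  where
  open Switch n σ i 1≤i (1+i≤2n n i 1≤n i≤2n-1) switchable
  open DistinctColumns
  open SameColumn
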